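{- Let $k\ge1$ be a natural number and let $R\subseteq\big({}^\omega({}^\omega2)\big)^k$ be a meager $k$-ary relation on ${}^\omega({}^\omega2)$. Then for each $i<k$ there is a sequence $\langle C^i_n:n\in\omega\rangle$ of perfect subsets of ${}^\omega2$ such that $\prod_{i<k}\prod_{n\in\omega}C^i_n$ is $R$-discrete, i.e. there are no $x_0,\dots,x_{k-1}$ with $x_i\in\prod_{n\in\omega}C^i_n$ for each $i<k$ and $(x_0,\dots,x_{k-1})\in R$.
   Context: ${}^\omega({}^\omega2)$ carries the product topology, and $R$ is meager in the product space $\big({}^\omega({}^\omega2)\big)^k$. -}

module Defs where

open import Data.Nat using (ℕ; _<_)
open import Data.Bool using (Bool)
open import Data.Fin using (Fin)
open import Data.Product using (Σ; ∃; _×_; _,_)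
open import Data.Empty using (⊥)
open import Relation.Nullary using (¬_)
open import Relation.Binary.PropositionalEquality using (_≡_; _≢_)

Cantor : Set
Cantor = ℕ → Bool

CantorSeq : Set
CantorSeq = ℕ → Cantor

Prod : ℕ → Set
Prod k = Fin k → CantorSeq

Subset : Set → Set₁
Subset X = X → Set

AgreeBelow : ℕ → Cantor → Cantor → Set
AgreeBelow n x y = ∀ j → j < n → x j ≡ y j

IsClosed : Subset Cantor → Set
IsClosed C = ∀ x → (∀ n → Σ Cantor λ y → C y × AgreeBelow n x y) → C x

IsPerfect : Subset Cantor → Set
IsPerfect C =
  (Σ Cantor C) ×
  IsClosed C ×
  (∀ x → C x → ∀ n → Σ Cantor λ y → C y × AgreeBelow n x y × (Σ ℕ λ j → y j ≢ x j))

-- Basic open set of (^ω(^ω2))^k: given by a depth m and a pattern p;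
-- it consists of all x with x i n j ≡ p i n j for all i < k, n < m, j < m.
-- These sets form a base of the product topology.
record BasicOpen (k : ℕ) : Set where
  constructor basic
  field
    depth   : ℕ
    pat     : Prod k

InBasic : ∀ {k} → BasicOpen k → Prod k → Set
InBasic (basic m p) x = ∀ i n j → n < m → j < m → x i n j ≡ p i n j

BasicSub : ∀ {k} → BasicOpen k → BasicOpen k → Set
BasicSub {k} V U = ∀ (x : Prod k) → InBasic V x → InBasic U x

NowhereDense : ∀ {k} → Subset (Prod k) → Set
NowhereDense {k} F =
  ∀ (U : BasicOpen k) → Σ (BasicOpen k) λ V →
    BasicSub V U × (∀ (x : Prod k) → InBasic V x → ¬ F x)

Meager : ∀ {k} → Subset (Prod k) → Set₁
Meager {k} R =
  Σ (ℕ → Subset (Prod k)) λ F →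
    (∀ n → NowhereDense (F n)) × (∀ (x : Prod k) → R x → Σ ℕ λ n → F n x)

-- Fix nowhere dense sets F m covering R. Stage by stage we build a basic
-- open set of (ω(ω2))^k, given by a depth D t and a pattern P t, together
-- with a finite set of free positions (n , j); at stage t the column E t,
-- lying beyond everything fixed so far, becomes free in every row n < D t.
-- During stage t the nowhere density of F t is used once for each of the
-- finitely many ways of filling the free positions, shrinking the basic
-- open set each time, so that afterwards every point agreeing with the
-- pattern off the free positions avoids F t. Positions that never become
-- free settle to a limit pattern, and C i n consists of the y that agree
-- with row n of component i of the limit outside the eventually free
-- columns of row n. These sets are closed, and perfect because every row has
-- infinitely many free columns.

module Submission where

open import Defs
open import Data.Bool using (Bool; true; false; not; if_then_else_)
open import Data.Bool.Properties using (not-¬)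
open import Data.Empty using (⊥; ⊥-elim)
open import Data.Fin using (Fin)
open import Data.Fin.Properties using () renaming (_≟_ to _≟ᶠ_)
open import Data.List using (List; []; _∷_; map; allFin; upTo; cartesianProduct; cartesianProductWith)
open import Data.List.Membership.Propositional using (_∈_; lose)
open import Data.List.Membership.Propositional.Properties
  using (∈-map⁺; ∈-allFin; ∈-upTo⁺; ∈-cartesianProduct⁺; ∈-cartesianProductWith⁺)
open import Data.List.Relation.Unary.Any using (Any; here; there; tail)
open import Data.Nat using (ℕ; zero; suc; _+_; _⊔_; _≤_; _<_; _≥_; _≤′_; ≤′-refl; ≤′-step; z≤n; s≤s; _≟_; _<?_)
open import Data.Nat.Properties
  using (≤-refl; ≤-trans; <-≤-trans; ≤-total; ≤⇒≤′; <⇒≤; <⇒≢; <⇒≱; m≤m⊔n; m≤n⊔m; m≤m+n; m≤n⇒m≤1+n; m≤n+m; m<n⇒m<1+n)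
open import Data.Product using (Σ; ∃; _×_; _,_; proj₁; proj₂)
open import Data.Product.Properties using (≡-dec)
open import Data.Sum using (_⊎_; inj₁; inj₂; [_,_])
open import Function using (_∘_)
open import Relation.Binary using (Decidable; DecidableEquality; _⇒_)
open import Relation.Nullary using (¬_; yes; no; does)
open import Relation.Nullary.Decidable using (dec-true; dec-false; _×-dec_; _⊎-dec_)
open import Relation.Binary.PropositionalEquality using (_≡_; _≢_; refl; sym; trans; cong)
open import Relation.Unary using (U)

≤-propagate : (Q : ℕ → Set) → (∀ t → Q t → Q (suc t)) → ∀ {t t′} → t ≤ t′ → Q t → Q t′
≤-propagate Q step t≤t′ = go (≤⇒≤′ t≤t′)
  where
    go : ∀ {t t′} → t ≤′ t′ → Q t → Q t′
    go ≤′-refl          q = q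
    go (≤′-step t≤t′) q = step _ (go t≤t′ q)

module _ {A : Set} (_≟ᴬ_ : DecidableEquality A) where

  update : {B : Set} → (A → B) → A → B → A → B
  update f a b a′ with a′ ≟ᴬ a
  ... | yes _ = b
  ... | no  _ = f a′

  update-≡ : ∀ {B} (f : A → B) a b → update f a b a ≡ b
  update-≡ f a b with a ≟ᴬ a
  ... | yes _   = refl
  ... | no  a≢a = ⊥-elim (a≢a refl)

  update-≢ : ∀ {B} (f : A → B) {a} b {a′} → a′ ≢ a → update f a b a′ ≡ f a′
  update-≢ f {a} b {a′} a′≢a with a′ ≟ᴬ a
  ... | yes a′≡a = ⊥-elim (a′≢a a′≡a)
  ... | no  _    = refl

  restrictionsOn : List A → List (A → Bool)
  restrictionsOn []       = (λ _ → false) ∷ []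
  restrictionsOn (a ∷ as) =
    cartesianProductWith (λ b g → update g a b) (true ∷ false ∷ []) (restrictionsOn as)

  restrictionsOn-cover : ∀ as (f : A → Bool) →
    ∃ λ g → g ∈ restrictionsOn as × (∀ {a} → a ∈ as → g a ≡ f a)
  restrictionsOn-cover []       f = _ , here refl , λ ()
  restrictionsOn-cover (a ∷ as) f
    with g , g∈ , g≈f ← restrictionsOn-cover as f =
    update g a (f a) , ∈-cartesianProductWith⁺ (λ b g → update g a b) (bool∈ (f a)) g∈ , extended
    where
      bool∈ : ∀ b → b ∈ true ∷ false ∷ []
      bool∈ true  = here refl
      bool∈ false = there (here refl)

      extended : ∀ {a′} → a′ ∈ a ∷ as → update g a (f a) a′ ≡ f a′
      extended {a′} a′∈ with a′ ≟ᴬ a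
      ... | yes refl = refl
      ... | no  a′≢a = g≈f (tail a′≢a a′∈)

AgreeOutside : (ℕ → Set) → Cantor → Subset Cantor
AgreeOutside S z y = ∀ j → ¬ S j → y j ≡ z j

agreeOutside-isPerfect : {S : ℕ → Set} (z : Cantor) →
  (∀ b → ∃ λ j → b ≤ j × S j) → IsPerfect (AgreeOutside S z)
agreeOutside-isPerfect {S} z unbounded = (z , λ _ _ → refl) , closed , noIsolatedPoint
  where
    closed : IsClosed (AgreeOutside S z)
    closed x near j ¬Sj with y , y∈ , x≈y ← near (suc j) = trans (x≈y j ≤-refl) (y∈ j ¬Sj)

    noIsolatedPoint : ∀ x → AgreeOutside S z x → ∀ b →
      ∃ λ y → AgreeOutside S z y × AgreeBelow b x y × ∃ λ j → y j ≢ x j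
    noIsolatedPoint x x∈ b with j₀ , b≤j₀ , Sj₀ ← unbounded b =
      flipped , flipped∈ , agree , j₀ , differs
      where
        flipped : Cantor
        flipped = update _≟_ x j₀ (not (x j₀))

        flipped∈ : AgreeOutside S z flipped
        flipped∈ j ¬Sj = trans (update-≢ _≟_ x _ λ { refl → ¬Sj Sj₀ }) (x∈ j ¬Sj)

        agree : AgreeBelow b x flipped
        agree j j<b = sym (update-≢ _≟_ x _ λ { refl → <⇒≱ j<b b≤j₀ })

        differs : flipped j₀ ≢ x j₀
        differs eq = not-¬ refl (trans (sym eq) (update-≡ _≟_ x j₀ _))

-- Sets of positions (n , j), shared by all k components of a point of Prod k.
Positions : Set₁
Positions = ℕ → ℕ → Set

InBox : ℕ → Positions
InBox d n j = n < d × j < d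

Fixed : ℕ → Positions → Positions
Fixed d S n j = InBox d n j × ¬ S n j

InBox-mono : ∀ {d d′} → d ≤ d′ → InBox d ⇒ InBox d′
InBox-mono d≤d′ (n<d , j<d) = <-≤-trans n<d d≤d′ , <-≤-trans j<d d≤d′

module _ {k : ℕ} where

  AgreeOn : Positions → Prod k → Prod k → Set
  AgreeOn S x y = ∀ i n j → S n j → x i n j ≡ y i n j

  patterns : ℕ → List (Prod k)
  patterns d = map (λ g i n j → g (i , n , j)) (restrictionsOn _≟ᶜ_ box)
    where
      _≟ᶜ_ : DecidableEquality (Fin k × ℕ × ℕ)
      _≟ᶜ_ = ≡-dec _≟ᶠ_ (≡-dec _≟_ _≟_)

      box : List (Fin k × ℕ × ℕ)
      box = cartesianProduct (allFin k) (cartesianProduct (upTo d) (upTo d))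

  patterns-cover : ∀ d (y : Prod k) → ∃ λ q → q ∈ patterns d × InBasic (basic d q) y
  patterns-cover d y with g , g∈ , g≈y ← restrictionsOn-cover _ _ (λ (i , n , j) → y i n j) =
    _ , ∈-map⁺ _ g∈ ,
    λ i n j n<d j<d → sym (g≈y (∈-cartesianProduct⁺ (∈-allFin i)
                                 (∈-cartesianProduct⁺ (∈-upTo⁺ n<d) (∈-upTo⁺ j<d))))

  overlay : {S : Positions} → Decidable S → Prod k → Prod k → Prod k
  overlay S? q p i n j = if does (S? n j) then q i n j else p i n j

  overlay-in : ∀ {S} (S? : Decidable S) {q p i n j} → S n j → overlay S? q p i n j ≡ q i n j
  overlay-in S? {q} {p} {i} {n} {j} s = cong (if_then q i n j else p i n j) (dec-true (S? n j) s)

  overlay-out : ∀ {S} (S? : Decidable S) {q p i n j} → ¬ S n j → overlay S? q p i n j ≡ p i n j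
  overlay-out S? {q} {p} {i} {n} {j} ¬s = cong (if_then q i n j else p i n j) (dec-false (S? n j) ¬s)

  pat∈basic : (V : BasicOpen k) → InBasic V (BasicOpen.pat V)
  pat∈basic V _ _ _ _ _ = refl

module _ {k : ℕ} {F : Subset (Prod k)} (F-nd : NowhereDense F) {S : Positions} (S? : Decidable S) where

  record Refinement (d : ℕ) (p : Prod k) (T : Subset (Prod k)) : Set where
    field
      depth   : ℕ
      pat     : Prod k
      d≤depth : d ≤ depth
      keeps   : AgreeOn (Fixed d S) pat p
      avoids  : ∀ y → T y → AgreeOn (Fixed depth S) y pat → ¬ F y

  refineFor : ∀ qs d p → S ⇒ InBox d → Refinement d p (λ y → Any (AgreeOn S y) qs)
  refineFor []       d p S⊆box = record
    { depth = d ; pat = p ; d≤depth = ≤-refl ; keeps = λ _ _ _ _ → refl ; avoids = λ _ () }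
  refineFor (q ∷ qs) d p S⊆box = record
    { depth   = depth
    ; pat     = pat
    ; d≤depth = ≤-trans (m≤m⊔n d (BasicOpen.depth V)) d≤depth
    ; keeps   = λ i n j (box , ¬s) →
        trans (keeps i n j (InBox-mono (m≤m⊔n _ _) box , ¬s))
              (trans (V⊆U i n j (proj₁ box) (proj₂ box)) (overlay-out S? {q} {p} ¬s))
    ; avoids  = λ { y (here y≈q) y≈pat → V∩F=∅ y (y∈V y≈q y≈pat)
                  ; y (there y≈qs) → avoids y y≈qs }
    }
    where
      Uq : BasicOpen k
      Uq = basic d (overlay S? q p)

      V : BasicOpen k
      V = proj₁ (F-nd Uq)

      V⊆U : InBasic Uq (BasicOpen.pat V)
      V⊆U = proj₁ (proj₂ (F-nd Uq)) (BasicOpen.pat V) (pat∈basic V)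

      V∩F=∅ : ∀ y → InBasic V y → ¬ F y
      V∩F=∅ = proj₂ (proj₂ (F-nd Uq))

      d₁ : ℕ
      d₁ = d ⊔ BasicOpen.depth V

      open Refinement (refineFor qs d₁ (BasicOpen.pat V) (InBox-mono (m≤m⊔n d _) ∘ S⊆box))

      y∈V : ∀ {y} → AgreeOn S y q → AgreeOn (Fixed depth S) y pat → InBasic V y
      y∈V {y} y≈q y≈pat i n j n< j< with S? n j
      ... | yes s = let (n<d , j<d) = S⊆box s in
        trans (y≈q i n j s) (trans (sym (overlay-in S? {q} {p} s)) (sym (V⊆U i n j n<d j<d)))
      ... | no ¬s = trans (y≈pat i n j (InBox-mono (≤-trans V≤d₁ d≤depth) (n< , j<) , ¬s))
                          (keeps i n j (InBox-mono V≤d₁ (n< , j<) , ¬s))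
        where
          V≤d₁ : BasicOpen.depth V ≤ d₁
          V≤d₁ = m≤n⊔m d _

  refine : ∀ d p → S ⇒ InBox d → Refinement d p U
  refine d p S⊆box = record
    { depth = depth ; pat = pat ; d≤depth = d≤depth ; keeps = keeps
    ; avoids = λ y _ → avoids y (covered y) }
    where
      open Refinement (refineFor (patterns d) d p S⊆box)

      covered : ∀ y → Any (AgreeOn S y) (patterns d)
      covered y with q , q∈ , y∈ ← patterns-cover d y =
        lose q∈ λ i n j s → let (n<d , j<d) = S⊆box s in y∈ i n j n<d j<d

module Construction {k : ℕ} (F : ℕ → Subset (Prod k)) (F-nd : ∀ m → NowhereDense (F m)) where

  record Stage : Set₁ where
    field
      depth    : ℕ
      pat      : Prod k
      Free     : Positions
      free?    : Decidable Free
      free⊆box : Free ⇒ InBox depth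

  refineStage : ∀ t (s : Stage) →
    Refinement (F-nd t) (Stage.free? s) (Stage.depth s) (Stage.pat s) U
  refineStage t s = refine (F-nd t) free? depth pat free⊆box
    where open Stage s

  next : ∀ t → Stage → Stage
  next t s = record
    { depth    = suc e
    ; pat      = pat′
    ; Free     = λ n j → (n < depth × j ≡ e) ⊎ Free n j
    ; free?    = λ n j → (n <? depth ×-dec j ≟ e) ⊎-dec free? n j
    ; free⊆box = λ { (inj₁ (n<d , refl)) → m<n⇒m<1+n (<-≤-trans n<d d≤e) , ≤-refl
                   ; (inj₂ free) → InBox-mono (m≤n⇒m≤1+n d≤e) (free⊆box free) }
    }
    where
      open Stage s
      open Refinement (refineStage t s) using () renaming (depth to e; pat to pat′; d≤depth to d≤e)

  stage : ℕ → Stage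
  stage zero    = record
    { depth = 0 ; pat = λ _ _ _ → false ; Free = λ _ _ → ⊥ ; free? = λ _ _ → no λ () ; free⊆box = λ () }
  stage (suc t) = next t (stage t)

  D : ℕ → ℕ
  D t = Stage.depth (stage t)

  P : ℕ → Prod k
  P t = Stage.pat (stage t)

  Free : ℕ → Positions
  Free t = Stage.Free (stage t)

  E : ℕ → ℕ
  E t = Refinement.depth (refineStage t (stage t))

  Settled : ℕ → Positions
  Settled t = Fixed (D t) (Free t)

  D≤E : ∀ t → D t ≤ E t
  D≤E t = Refinement.d≤depth (refineStage t (stage t))

  t≤D : ∀ t → t ≤ D t
  t≤D zero    = z≤n
  t≤D (suc t) = s≤s (≤-trans (t≤D t) (D≤E t))

  Free-mono : ∀ {t t′ n j} → t ≤ t′ → Free t n j → Free t′ n j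
  Free-mono {n = n} {j} = ≤-propagate (λ u → Free u n j) (λ _ → inj₂)

  settled-suc : ∀ {t n j} → Settled t n j → Settled (suc t) n j
  settled-suc {t} (box , ¬free) =
    InBox-mono (m≤n⇒m≤1+n (D≤E t)) box ,
    [ (λ (_ , j≡E) → <⇒≢ (<-≤-trans (proj₂ box) (D≤E t)) j≡E) , ¬free ]

  settled-mono : ∀ {t t′ n j} → t ≤ t′ → Settled t n j → Settled t′ n j
  settled-mono {n = n} {j} = ≤-propagate (λ u → Settled u n j) (λ _ → settled-suc)

  pattern-stable : ∀ {t t′ i n j} → t ≤ t′ → Settled t n j → P t′ i n j ≡ P t i n j
  pattern-stable {t} {i = i} {n} {j} t≤t′ settled =
    proj₂ (≤-propagate (λ u → Settled u n j × P u i n j ≡ P t i n j) step t≤t′ (settled , refl))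
    where
      step : ∀ u → Settled u n j × P u i n j ≡ P t i n j → Settled (suc u) n j × P (suc u) i n j ≡ P t i n j
      step u (settled-u , eq) =
        settled-suc settled-u , trans (Refinement.keeps (refineStage u (stage u)) i n j settled-u) eq

  EventuallyFree : Positions
  EventuallyFree n j = ∃ λ t → Free t n j

  settled⇒never-free : ∀ {t n j} → Settled t n j → ¬ EventuallyFree n j
  settled⇒never-free {t} settled (u , free) with ≤-total t u
  ... | inj₁ t≤u = proj₂ (settled-mono t≤u settled) free
  ... | inj₂ u≤t = proj₂ settled (Free-mono u≤t free)

  eventuallyFree-unbounded : ∀ n b → ∃ λ j → b ≤ j × EventuallyFree n j
  eventuallyFree-unbounded n b = E s , <⇒≤ (<-≤-trans b<D (D≤E s)) , suc s , inj₁ (n<D , refl)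
    where
      s : ℕ
      s = suc (n + b)

      n<D : n < D s
      n<D = ≤-trans (s≤s (m≤m+n n b)) (t≤D s)

      b<D : b < D s
      b<D = ≤-trans (s≤s (m≤n+m b n)) (t≤D s)

  -- Stage suc (n + j) is one whose box contains (n , j).
  limit : Prod k
  limit i n j = P (suc (n + j)) i n j

  pattern≡limit : ∀ {t i n j} → Settled t n j → P t i n j ≡ limit i n j
  pattern≡limit {t} {i} {n} {j} settled with ≤-total t (suc (n + j))
  ... | inj₁ t≤s = sym (pattern-stable t≤s settled)
  ... | inj₂ s≤t = pattern-stable s≤t (inBox , λ free → proj₂ settled (Free-mono s≤t free))
    where
      inBox : InBox (D (suc (n + j))) n j
      inBox = ≤-trans (s≤s (m≤m+n n j)) (t≤D _) , ≤-trans (s≤s (m≤n+m j n)) (t≤D _)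

  C : Fin k → ℕ → Subset Cantor
  C i n = AgreeOutside (EventuallyFree n) (limit i n)

  C-isPerfect : ∀ i n → IsPerfect (C i n)
  C-isPerfect i n = agreeOutside-isPerfect (limit i n) (eventuallyFree-unbounded n)

  ∏C-avoids : ∀ m (x : Prod k) → (∀ i n → C i n (x i n)) → ¬ F m x
  ∏C-avoids m x x∈C = Refinement.avoids (refineStage m (stage m)) x _ agree
    where
      agree : AgreeOn (Fixed (E m) (Free m)) x (P (suc m))
      agree i n j ((n<E , j<E) , ¬free) =
        trans (x∈C i n j (settled⇒never-free {suc m} settled)) (sym (pattern≡limit {suc m} settled))
        where
          settled : Settled (suc m) n j
          settled = (m<n⇒m<1+n n<E , m<n⇒m<1+n j<E) , [ (λ (_ , j≡E) → <⇒≢ j<E j≡E) , ¬free ]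

corollary3p13 : (k : ℕ) → k ≥ 1 → (R : Subset (Prod k)) → Meager R →
    Σ (Fin k → ℕ → Subset Cantor) λ C →
      (∀ i n → IsPerfect (C i n)) ×
      (∀ (x : Prod k) → (∀ i n → C i n (x i n)) → ¬ R x)
corollary3p13 k _ R (F , F-nd , F-covers) =
  C , C-isPerfect , λ x x∈C Rx → let (m , Fx) = F-covers x Rx in ∏C-avoids m x x∈C Fx
  where open Construction F F-nd
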